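{- Let $p$ be a prime and let $q$ be a power of $p$. Then for every $n\in\mathbb{N}$, $h_q(pn)\le p\,h_q(n)$.
   Context: For $n\in\mathbb{N}$, let $\sigma:\mathbb{F}_q^n\to\mathbb{F}_q^n$ be the cyclic shift $\sigma(\sum_{i=0}^{n-1}x_ie_i)=\sum_{i=0}^{n-1}x_ie_{i+1}$ (indices mod $n$). A subspace $U\le\mathbb{F}_q^n$ is cyclically covering if $\bigcup_{i=0}^{n-1}\sigma^i(U)=\mathbb{F}_q^n$. $h_q(n)$ denotes the largest possible codimension of a cyclically covering subspace of $\mathbb{F}_q^n$. -}

module Defs where

open import Level using (0ℓ)
open import Data.Nat using (ℕ; zero; suc; _<_)
open import Data.Fin using (Fin; zero; suc; fromℕ; inject₁)
open import Data.Vec using (Vec; []; _∷_; lookup; tabulate; zipWith; map; replicate)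
open import Data.Product using (Σ; ∃; ∃-syntax; _×_; _,_)
open import Relation.Binary.PropositionalEquality using (_≡_; _≢_)
open import Algebra.Structures using (IsCommutativeRing)
open import Function.Bundles using (_↔_)

record FiniteField (q : ℕ) : Set₁ where
  field
    Carrier : Set
    _+_ _*_ : Carrier → Carrier → Carrier
    -_      : Carrier → Carrier
    0# 1#   : Carrier
    isCommutativeRing : IsCommutativeRing _≡_ _+_ _*_ -_ 0# 1#
    0≢1     : 0# ≢ 1#
    inverse : ∀ x → x ≢ 0# → ∃[ y ] (x * y ≡ 1#)
    card    : Carrier ↔ Fin q


module LinearAlgebra {q : ℕ} (F : FiniteField q) where
  open FiniteField F

  V : ℕ → Set
  V m = Vec Carrier m

  0V : ∀ {m} → V m
  0V = replicate _ 0#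

  _+V_ : ∀ {m} → V m → V m → V m
  _+V_ = zipWith _+_

  _·V_ : ∀ {m} → Carrier → V m → V m
  c ·V x = map (c *_) x

  lincomb : ∀ {m d} → Vec Carrier d → Vec (V m) d → V m
  lincomb [] [] = 0V
  lincomb (c ∷ cs) (b ∷ bs) = (c ·V b) +V lincomb cs bs

  record IsSubspace {m : ℕ} (U : V m → Set) : Set where
    field
      zero-mem : U 0V
      +-mem    : ∀ {x y} → U x → U y → U (x +V y)
      ·-mem    : ∀ c {x} → U x → U (c ·V x)

  record IsBasis {m d : ℕ} (U : V m → Set) (b : Vec (V m) d) : Set where
    field
      in-U        : ∀ k → U (lookup b k)
      independent : ∀ (c : Vec Carrier d) → lincomb c b ≡ 0V → ∀ k → lookup c k ≡ 0#
      spanning    : ∀ x → U x → ∃[ c ] (x ≡ lincomb c b)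

  HasDim : ∀ {m} → (V m → Set) → ℕ → Set
  HasDim {m} U d = Σ (Vec (V m) d) (IsBasis U)

  -- cyclic shift σ(Σ x_i e_i) = Σ x_i e_{i+1}, i.e. (σ x)_j = x_{j-1 mod n}
  predMod : ∀ {n} → Fin n → Fin n
  predMod {suc n} zero    = fromℕ n
  predMod {suc n} (suc i) = inject₁ i

  σ : ∀ {n} → V n → V n
  σ x = tabulate (λ j → lookup x (predMod j))

  σ^ : ∀ {n} → ℕ → V n → V n
  σ^ zero    x = x
  σ^ (suc i) x = σ (σ^ i x)

  CyclicallyCovering : ∀ {n} → (V n → Set) → Set
  CyclicallyCovering {n} U =
    ∀ (x : V n) → ∃[ i ] (i < n × ∃[ y ] (U y × σ^ i y ≡ x))

module Submission where

-- Let U ≤ F^N, N = p·n, be cyclically covering of dimension d.  Let A = σ^n (shift by one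
-- block of length n) and T = A − 1.  As F has characteristic p and A^p = σ^N = 1, the
-- binomial theorem gives T^p = A^p − 1 = 0.  Let ι : F^n → F^N place a vector in the first
-- block and Φ = T^(p−1) ∘ ι; Φ is injective and commutes with σ.  For k < p the layer
-- W_k = Φ⁻¹ (T^k (U ∩ ker T^(k+1))) is a subspace of F^n, and it is cyclically covering:
-- for y ∈ F^n some shift of T^(p−1−k) (ι y) lies in U.  Lifting bases of W_0, …, W_(p−1)
-- to U gives an independent family (T^k separates layer k from the layers below it), so
-- Σ_k dim W_k ≤ d, and a layer of least dimension e has p·e ≤ d, i.e. pn − d ≤ p(n − e).

open import Defs
open import Level using (0ℓ)
import Data.Nat as Nat
open import Data.Nat using (ℕ; zero; suc; z≤n; s≤s)
import Data.Nat.Properties as ℕP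
open import Data.Nat.Combinatorics using (_C_; nC1≡n; nCn≡1; nCk+nC[k+1]≡[n+1]C[k+1]; k>n⇒nCk≡0)
open import Data.Nat.Divisibility using (_∣_; divides; ∣⇒≤)
open import Data.Nat.DivMod using (_%_; _/_; m≡m%n+[m/n]*n; m%n<n)
open import Data.Nat.Primality using (Prime; euclidsLemma; ¬prime[0]; ¬prime[1])
open import Data.Product using (∃; ∃-syntax; _×_; _,_; proj₁; proj₂)
open import Data.Sum using (inj₁; inj₂; [_,_]′)
open import Relation.Nullary using (¬_; Dec; yes; no)
open import Data.Empty using (⊥-elim)
open import Relation.Binary.PropositionalEquality
open import Relation.Binary.Definitions using (DecidableEquality; tri<; tri≈; tri>)
open import Relation.Nullary.Decidable using (map′; _×-dec_; ¬?)
open import Function.Bundles using (Inverse; Injection; _↔_; mk↔ₛ′)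
open import Function.Properties.Inverse using (↔-sym; ↔-trans; ↔⇒↣)
open import Function.Definitions using (Injective)
open import Data.Vec.Recursive using (lift↔; Fin[m^n]↔Fin[m]^n)
open import Data.Vec.Recursive.Properties using (↔Vec)
open import Algebra.Bundles using (CommutativeRing; Semiring)
import Algebra.Properties.Ring as RingProperties
import Algebra.Properties.AbelianGroup as AbelianGroupProperties
import Algebra.Properties.CommutativeSemigroup as CommutativeSemigroupProperties
import Algebra.Properties.CommutativeMonoid.Sum as SumProperties
import Algebra.Properties.Monoid.Mult as MultProperties
import Algebra.Properties.Semiring.Mult as SemiringMultProperties
import Algebra.Definitions.RawSemiring as RawSemiringDefinitions
open import Data.Fin as Fin using (Fin; toℕ)
open import Data.Vec as Vec using (Vec; []; _∷_; lookup; map; _++_)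
import Data.Vec.Properties as VecP
import Data.Fin.Properties as FinP

module Arithmetic where
  open Nat using (_+_; _*_; _∸_; _≤_; _<_)
  open ℕP

  absorption : ∀ n k → suc k * (suc n C suc k) ≡ suc n * (n C k)
  absorption zero    zero    = refl
  absorption zero    (suc k) = begin
    suc (suc k) * (1 C suc (suc k)) ≡⟨ cong (suc (suc k) *_) (k>n⇒nCk≡0 {1} {suc (suc k)} (s≤s (s≤s z≤n))) ⟩
    suc (suc k) * 0                 ≡⟨ *-zeroʳ (suc (suc k)) ⟩
    0                               ≡⟨ cong (1 *_) (sym (k>n⇒nCk≡0 {0} {suc k} (s≤s z≤n))) ⟩
    1 * (0 C suc k)                 ∎
    where open ≡-Reasoning
  absorption (suc n) zero    = begin
    1 * (suc (suc n) C 1) ≡⟨ *-identityˡ _ ⟩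
    suc (suc n) C 1       ≡⟨ nC1≡n (suc (suc n)) ⟩
    suc (suc n)           ≡⟨ sym (*-identityʳ (suc (suc n))) ⟩
    suc (suc n) * 1       ∎
    where open ≡-Reasoning
  absorption (suc n) (suc k) = begin
    suc (suc k) * (suc (suc n) C suc (suc k))
      ≡⟨ cong (suc (suc k) *_) (sym (nCk+nC[k+1]≡[n+1]C[k+1] (suc n) (suc k))) ⟩
    suc (suc k) * (a + b)
      ≡⟨ *-distribˡ-+ (suc (suc k)) a b ⟩
    suc (suc k) * a + suc (suc k) * b
      ≡⟨ cong (_+ suc (suc k) * b) (+-comm a (suc k * a)) ⟩
    (suc k * a + a) + suc (suc k) * b
      ≡⟨ +-assoc (suc k * a) a (suc (suc k) * b) ⟩
    suc k * a + (a + suc (suc k) * b)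
      ≡⟨ cong₂ (λ x y → x + (a + y)) (absorption n k) (absorption n (suc k)) ⟩
    suc n * (n C k) + (a + suc n * (n C suc k))
      ≡⟨ cong (λ x → suc n * (n C k) + (x + suc n * (n C suc k))) (sym (nCk+nC[k+1]≡[n+1]C[k+1] n k)) ⟩
    suc n * (n C k) + ((n C k + n C suc k) + suc n * (n C suc k))
      ≡⟨ regroup (n C k) (n C suc k) ⟩
    suc (suc n) * (n C k + n C suc k)
      ≡⟨ cong (suc (suc n) *_) (nCk+nC[k+1]≡[n+1]C[k+1] n k) ⟩
    suc (suc n) * a ∎
    where
    open ≡-Reasoning
    a b : ℕ
    a = suc n C suc k
    b = suc n C suc (suc k)
    regroup : ∀ x y → suc n * x + ((x + y) + suc n * y) ≡ suc (suc n) * (x + y)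
    regroup x y = begin
      suc n * x + ((x + y) + suc n * y) ≡⟨ cong (suc n * x +_) (+-assoc x y (suc n * y)) ⟩
      suc n * x + (x + suc (suc n) * y) ≡⟨ sym (+-assoc (suc n * x) x _) ⟩
      (suc n * x + x) + suc (suc n) * y ≡⟨ cong (_+ suc (suc n) * y) (+-comm (suc n * x) x) ⟩
      suc (suc n) * x + suc (suc n) * y ≡⟨ sym (*-distribˡ-+ (suc (suc n)) x y) ⟩
      suc (suc n) * (x + y)             ∎

  prime∣binomial : ∀ {p} j → Prime p → 0 < j → j < p → p ∣ p C j
  prime∣binomial {suc n} (suc k) pr _ j<p
    with euclidsLemma (suc k) (suc n C suc k) pr
           (divides (n C k) (trans (absorption n k) (*-comm (suc n) (n C k))))
  ... | inj₁ p∣j = ⊥-elim (<⇒≱ j<p (∣⇒≤ p∣j))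
  ... | inj₂ p∣C = p∣C

  sumBelow : (ℕ → ℕ) → ℕ → ℕ
  sumBelow f zero    = 0
  sumBelow f (suc m) = f m + sumBelow f m

  least-value : ∀ (f : ℕ → ℕ) m → ∃[ k ] (k < suc m × (∀ j → j < suc m → f k ≤ f j))
  least-value f zero = 0 , s≤s z≤n , λ { zero _ → ≤-refl ; (suc j) (s≤s ()) }
  least-value f (suc m) with least-value f m
  ... | k , k≤m , least with f k ≤? f (suc m)
  ...   | yes fk≤ = k , m<n⇒m<1+n k≤m , λ j j≤m+1 →
            [ least j , (λ { refl → fk≤ }) ]′ (m<1+n⇒m<n∨m≡n j≤m+1)
  ...   | no  fk≰ = suc m , ≤-refl , λ j j≤m+1 →
            [ (λ j≤m → ≤-trans (<⇒≤ (≰⇒> fk≰)) (least j j≤m)) , (λ { refl → ≤-refl }) ]′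
              (m<1+n⇒m<n∨m≡n j≤m+1)

  sum-lower-bound : ∀ (f : ℕ → ℕ) c m → (∀ j → j < m → c ≤ f j) → m * c ≤ sumBelow f m
  sum-lower-bound f c zero    _     = z≤n
  sum-lower-bound f c (suc m) bound =
    +-mono-≤ (bound m ≤-refl) (sum-lower-bound f c m (λ j j<m → bound j (m<n⇒m<1+n j<m)))

  below-average : ∀ (f : ℕ → ℕ) m → ∃[ k ] (k < suc m × suc m * f k ≤ sumBelow f (suc m))
  below-average f m with least-value f m
  ... | k , k≤m , least = k , k≤m , sum-lower-bound f (f k) (suc m) least

  mod-complement : ∀ p n i .{{_ : Nat.NonZero n}} → i ≤ p * n → i % n + (p * n ∸ i) ≡ (p ∸ i / n) * n
  mod-complement p n i i≤pn = sym (begin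
    (p ∸ i / n) * n                                ≡⟨ *-distribʳ-∸ n p (i / n) ⟩
    p * n ∸ (i / n) * n                            ≡⟨ cong (_∸ (i / n) * n) (sym total) ⟩
    (i % n + (p * n ∸ i)) + (i / n) * n ∸ (i / n) * n ≡⟨ m+n∸n≡m _ ((i / n) * n) ⟩
    i % n + (p * n ∸ i)                            ∎)
    where
    open ≡-Reasoning
    total : (i % n + (p * n ∸ i)) + (i / n) * n ≡ p * n
    total = begin
      (i % n + (p * n ∸ i)) + (i / n) * n ≡⟨ +-assoc (i % n) _ _ ⟩
      i % n + ((p * n ∸ i) + (i / n) * n) ≡⟨ cong (i % n +_) (+-comm (p * n ∸ i) _) ⟩
      i % n + ((i / n) * n + (p * n ∸ i)) ≡⟨ sym (+-assoc (i % n) _ _) ⟩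
      (i % n + (i / n) * n) + (p * n ∸ i) ≡⟨ cong (_+ (p * n ∸ i)) (sym (m≡m%n+[m/n]*n i n)) ⟩
      i + (p * n ∸ i)                     ≡⟨ m+[n∸m]≡n i≤pn ⟩
      p * n                               ∎

  codim-bound : ∀ p n d e → p * e ≤ d → p * n ∸ d ≤ p * (n ∸ e)
  codim-bound p n d e pe≤d = begin
    p * n ∸ d     ≤⟨ ∸-monoʳ-≤ (p * n) pe≤d ⟩
    p * n ∸ p * e ≡⟨ sym (*-distribˡ-∸ p n e) ⟩
    p * (n ∸ e)   ∎
    where open ≤-Reasoning


open Arithmetic

module Iteration where
  module _ {A : Set} where
    open import Function.Endo.Propositional A public using (_^_; ^-homo)

  ^-add : ∀ {A : Set} (f : A → A) m n x → (f ^ (m Nat.+ n)) x ≡ (f ^ m) ((f ^ n) x)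
  ^-add f m n x = cong-app (^-homo f m n) x

  ^-mult : ∀ {A : Set} (f : A → A) j m x → ((f ^ m) ^ j) x ≡ (f ^ (j Nat.* m)) x
  ^-mult f zero    m x = refl
  ^-mult f (suc j) m x = trans (cong (f ^ m) (^-mult f j m x)) (sym (^-add f m (j Nat.* m) x))

  ^-identity : ∀ {A : Set} m (x : A) → ((λ y → y) ^ m) x ≡ x
  ^-identity zero    x = refl
  ^-identity (suc m) x = ^-identity m x

  ^-intertwine : ∀ {A B : Set} {f : A → B} {g : A → A} {h : B → B} →
                 (∀ x → f (g x) ≡ h (f x)) → ∀ m x → f ((g ^ m) x) ≡ (h ^ m) (f x)
  ^-intertwine fg≡hf zero    x = refl
  ^-intertwine {h = h} fg≡hf (suc m) x = trans (fg≡hf _) (cong h (^-intertwine fg≡hf m x))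

module FieldTheory {q : ℕ} (F : FiniteField q) where
  CR : CommutativeRing 0ℓ 0ℓ
  CR = record { isCommutativeRing = FiniteField.isCommutativeRing F }

  open CommutativeRing CR
    using ( Carrier; _+_; _*_; -_; 0#; 1#; +-assoc; +-comm; *-assoc; *-comm
          ; +-identityˡ; +-identityʳ; *-identityˡ; *-identityʳ; -‿inverseˡ; -‿inverseʳ
          ; distribˡ; distribʳ; zeroˡ; zeroʳ; ring; +-abelianGroup; +-commutativeMonoid
          ; +-monoid; semiring; +-commutativeSemigroup )
  open RingProperties ring using (-1*x≈-x; -‿involutive)
  open AbelianGroupProperties +-abelianGroup using (identityˡ-unique; inverseˡ-unique)
  open RawSemiringDefinitions (Semiring.rawSemiring semiring) using () renaming (_×_ to _⊗_; _^_ to _^ᶠ_)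
  open MultProperties +-monoid using (×-homo-+; ×-assocˡ)
  open SemiringMultProperties semiring using (×1-homo-*; ×-assoc-*; ×-comm-*)
  open FiniteField F using (0≢1; inverse; card)
  open Inverse card using (to; from; strictlyInverseʳ)
  open LinearAlgebra F
  open Iteration

  module Scalars where
    _≟_ : DecidableEquality Carrier
    x ≟ y = map′ (λ e → trans (sym (strictlyInverseʳ x)) (trans (cong from e) (strictlyInverseʳ y)))
                 (cong to) (to x FinP.≟ to y)

    no-zero-divisors : ∀ {a b} → a ≢ 0# → b ≢ 0# → a * b ≢ 0#
    no-zero-divisors {a} {b} a≢0 b≢0 ab≡0 = b≢0 (begin
      b             ≡⟨ sym (*-identityˡ b) ⟩
      1# * b        ≡⟨ cong (_* b) (sym (trans (*-comm a⁻¹ a) a*a⁻¹≡1)) ⟩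
      (a⁻¹ * a) * b ≡⟨ *-assoc a⁻¹ a b ⟩
      a⁻¹ * (a * b) ≡⟨ cong (a⁻¹ *_) ab≡0 ⟩
      a⁻¹ * 0#      ≡⟨ zeroʳ a⁻¹ ⟩
      0#            ∎)
      where
      open ≡-Reasoning
      a⁻¹ : Carrier
      a⁻¹ = proj₁ (inverse a a≢0)
      a*a⁻¹≡1 : a * a⁻¹ ≡ 1#
      a*a⁻¹≡1 = proj₂ (inverse a a≢0)

    translation : Carrier ↔ Carrier
    translation = mk↔ₛ′ (1# +_) (- 1# +_) (cancel 1# (- 1#) (-‿inverseʳ 1#)) (cancel (- 1#) 1# (-‿inverseˡ 1#))
      where
      cancel : ∀ a b → a + b ≡ 0# → ∀ x → a + (b + x) ≡ x
      cancel a b a+b≡0 x = trans (sym (+-assoc a b x)) (trans (cong (_+ x) a+b≡0) (+-identityˡ x))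

    -- q·1 = 0: translating by 1 does not change the sum S of all elements of F,
    -- but it adds q·1 to it.
    card-char : q ⊗ 1# ≡ 0#
    card-char = identityˡ-unique (q ⊗ 1#) S (sym (begin
      S                        ≡⟨ sum-permute from (↔-trans (↔-sym card) (↔-trans translation card)) ⟩
      sum (λ i → from (to (1# + from i))) ≡⟨ sum-cong-≗ (λ i → strictlyInverseʳ (1# + from i)) ⟩
      sum {q} (λ i → 1# + from i)  ≡⟨ ∑-distrib-+ (λ _ → 1#) from ⟩
      sum {q} (λ _ → 1#) + S       ≡⟨ cong (_+ S) (sum-replicate q) ⟩
      q ⊗ 1# + S               ∎))
      where
      open ≡-Reasoning
      open SumProperties +-commutativeMonoid using (sum; sum-permute; sum-cong-≗; ∑-distrib-+; sum-replicate)
      S : Carrier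
      S = sum from

    -- If q = p^(k+1) then p·1 = 0, since otherwise every power of p·1 would be nonzero.
    char-from-card : ∀ p k → q ≡ p Nat.^ suc k → p ⊗ 1# ≡ 0#
    char-from-card p k q≡pᵏ⁺¹ with (p ⊗ 1#) ≟ 0#
    ... | yes p≡0 = p≡0
    ... | no  p≢0 = ⊥-elim (powers-nonzero (suc k) (trans (cong (_⊗ 1#) (sym q≡pᵏ⁺¹)) card-char))
      where
      powers-nonzero : ∀ m → (p Nat.^ m) ⊗ 1# ≢ 0#
      powers-nonzero zero    1+0≡0 = 0≢1 (sym (trans (sym (+-identityʳ 1#)) 1+0≡0))
      powers-nonzero (suc m) pᵐ⁺¹≡0 =
        no-zero-divisors p≢0 (powers-nonzero m) (trans (sym (×1-homo-* p (p Nat.^ m))) pᵐ⁺¹≡0)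

    char-multiple : ∀ {p m} → p ⊗ 1# ≡ 0# → p ∣ m → ∀ x → m ⊗ x ≡ 0#
    char-multiple {p} p≡0 (divides t refl) x = begin
      (t Nat.* p) ⊗ x ≡⟨ sym (×-assocˡ x t p) ⟩
      t ⊗ (p ⊗ x)      ≡⟨ cong (t ⊗_) p⊗x≡0 ⟩
      t ⊗ 0#           ≡⟨ zeros t ⟩
      0#               ∎
      where
      open ≡-Reasoning
      p⊗x≡0 : p ⊗ x ≡ 0#
      p⊗x≡0 = begin
        p ⊗ x        ≡⟨ cong (p ⊗_) (sym (*-identityˡ x)) ⟩
        p ⊗ (1# * x) ≡⟨ sym (×-assoc-* p 1# x) ⟩
        (p ⊗ 1#) * x ≡⟨ cong (_* x) p≡0 ⟩
        0# * x       ≡⟨ zeroˡ x ⟩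
        0#           ∎
      zeros : ∀ t → t ⊗ 0# ≡ 0#
      zeros zero    = refl
      zeros (suc t) = trans (+-identityˡ _) (zeros t)

  module Vectors where
    vext : ∀ {A : Set} {m} {x y : Vec A m} → (∀ i → lookup x i ≡ lookup y i) → x ≡ y
    vext {x = x} {y} same = trans (sym (VecP.tabulate∘lookup x))
                              (trans (VecP.tabulate-cong same) (VecP.tabulate∘lookup y))

    lookup-+V : ∀ {m} (x y : V m) i → lookup (x +V y) i ≡ lookup x i + lookup y i
    lookup-+V x y i = VecP.lookup-zipWith _+_ i x y

    lookup-·V : ∀ {m} c (x : V m) i → lookup (c ·V x) i ≡ c * lookup x i
    lookup-·V c x i = VecP.lookup-map i (c *_) x

    lookup-0V : ∀ {m} (i : Fin m) → lookup (0V {m}) i ≡ 0#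
    lookup-0V i = VecP.lookup-replicate i 0#

    +V-assoc : ∀ {m} (x y z : V m) → (x +V y) +V z ≡ x +V (y +V z)
    +V-assoc x y z = VecP.zipWith-assoc +-assoc x y z

    +V-comm : ∀ {m} (x y : V m) → x +V y ≡ y +V x
    +V-comm x y = VecP.zipWith-comm +-comm x y

    +V-identityˡ : ∀ {m} (x : V m) → 0V +V x ≡ x
    +V-identityˡ x = VecP.zipWith-identityˡ +-identityˡ x

    +V-identityʳ : ∀ {m} (x : V m) → x +V 0V ≡ x
    +V-identityʳ x = VecP.zipWith-identityʳ +-identityʳ x

    +V-interchange : ∀ {m} (x y z w : V m) → (x +V y) +V (z +V w) ≡ (x +V z) +V (y +V w)
    +V-interchange x y z w = vext λ i → begin
      lookup ((x +V y) +V (z +V w)) i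
        ≡⟨ trans (lookup-+V (x +V y) (z +V w) i) (cong₂ _+_ (lookup-+V x y i) (lookup-+V z w i)) ⟩
      (lookup x i + lookup y i) + (lookup z i + lookup w i)
        ≡⟨ interchange _ _ _ _ ⟩
      (lookup x i + lookup z i) + (lookup y i + lookup w i)
        ≡⟨ sym (trans (lookup-+V (x +V z) (y +V w) i) (cong₂ _+_ (lookup-+V x z i) (lookup-+V y w i))) ⟩
      lookup ((x +V z) +V (y +V w)) i ∎
      where
      open ≡-Reasoning
      open CommutativeSemigroupProperties +-commutativeSemigroup using (interchange)

    +V-swap : ∀ {m} (x y z : V m) → x +V (y +V z) ≡ y +V (x +V z)
    +V-swap x y z = trans (sym (+V-assoc x y z)) (trans (cong (_+V z) (+V-comm x y)) (+V-assoc y x z))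

    ·V-distribˡ : ∀ {m} c (x y : V m) → c ·V (x +V y) ≡ (c ·V x) +V (c ·V y)
    ·V-distribˡ c x y = vext λ i →
      trans (lookup-·V c (x +V y) i) (trans (cong (c *_) (lookup-+V x y i)) (trans (distribˡ c _ _)
        (sym (trans (lookup-+V (c ·V x) (c ·V y) i) (cong₂ _+_ (lookup-·V c x i) (lookup-·V c y i))))))

    ·V-distribʳ : ∀ {m} c d (x : V m) → (c + d) ·V x ≡ (c ·V x) +V (d ·V x)
    ·V-distribʳ c d x = vext λ i →
      trans (lookup-·V (c + d) x i) (trans (distribʳ _ c d)
        (sym (trans (lookup-+V (c ·V x) (d ·V x) i) (cong₂ _+_ (lookup-·V c x i) (lookup-·V d x i)))))

    ·V-assoc : ∀ {m} c d (x : V m) → c ·V (d ·V x) ≡ (c * d) ·V x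
    ·V-assoc c d x = vext λ i →
      trans (lookup-·V c (d ·V x) i) (trans (cong (c *_) (lookup-·V d x i))
        (trans (sym (*-assoc c d _)) (sym (lookup-·V (c * d) x i))))

    ·V-identity : ∀ {m} (x : V m) → 1# ·V x ≡ x
    ·V-identity x = vext λ i → trans (lookup-·V 1# x i) (*-identityˡ _)

    ·V-zeroˡ : ∀ {m} (x : V m) → 0# ·V x ≡ 0V
    ·V-zeroˡ x = vext λ i → trans (lookup-·V 0# x i) (trans (zeroˡ _) (sym (lookup-0V i)))

    ·V-zeroʳ : ∀ {m} c → c ·V (0V {m}) ≡ 0V
    ·V-zeroʳ c = vext λ i →
      trans (lookup-·V c 0V i) (trans (cong (c *_) (lookup-0V i)) (trans (zeroʳ c) (sym (lookup-0V i))))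

    infixl 6 _-V_
    _-V_ : ∀ {m} → V m → V m → V m
    x -V y = x +V ((- 1#) ·V y)

    +V≡0⇒≡neg : ∀ {m} (x y : V m) → x +V y ≡ 0V → x ≡ (- 1#) ·V y
    +V≡0⇒≡neg x y x+y≡0 = vext λ i → begin
      lookup x i              ≡⟨ inverseˡ-unique _ _ (trans (sym (lookup-+V x y i))
                                   (trans (cong (λ v → lookup v i) x+y≡0) (lookup-0V i))) ⟩
      - lookup y i            ≡⟨ sym (-1*x≈-x _) ⟩
      (- 1#) * lookup y i     ≡⟨ sym (lookup-·V _ y i) ⟩
      lookup ((- 1#) ·V y) i  ∎
      where open ≡-Reasoning

    -V≡0⇒≡ : ∀ {m} (x y : V m) → x -V y ≡ 0V → x ≡ y
    -V≡0⇒≡ x y x-y≡0 = begin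
      x                          ≡⟨ +V≡0⇒≡neg x _ x-y≡0 ⟩
      (- 1#) ·V ((- 1#) ·V y)    ≡⟨ ·V-assoc _ _ y ⟩
      ((- 1#) * (- 1#)) ·V y     ≡⟨ cong (_·V y) (trans (-1*x≈-x (- 1#)) (-‿involutive 1#)) ⟩
      1# ·V y                    ≡⟨ ·V-identity y ⟩
      y                          ∎
      where open ≡-Reasoning

    -V-self : ∀ {m} (x : V m) → x -V x ≡ 0V
    -V-self x = begin
      x +V ((- 1#) ·V x)             ≡⟨ cong (_+V ((- 1#) ·V x)) (sym (·V-identity x)) ⟩
      (1# ·V x) +V ((- 1#) ·V x)     ≡⟨ sym (·V-distribʳ 1# (- 1#) x) ⟩
      (1# + - 1#) ·V x               ≡⟨ cong (_·V x) (-‿inverseʳ 1#) ⟩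
      0# ·V x                        ≡⟨ ·V-zeroˡ x ⟩
      0V                             ∎
      where open ≡-Reasoning

  module LinearMaps where
    open Vectors

    record Linear {a b} (L : V a → V b) : Set where
      field
        +-hom : ∀ x y → L (x +V y) ≡ L x +V L y
        ·-hom : ∀ c x → L (c ·V x) ≡ c ·V L x

      0-hom : L 0V ≡ 0V
      0-hom = trans (cong L (sym (·V-zeroˡ 0V))) (trans (·-hom 0# 0V) (·V-zeroˡ _))

      -‿hom : ∀ x y → L (x -V y) ≡ L x -V L y
      -‿hom x y = trans (+-hom x _) (cong (L x +V_) (·-hom (- 1#) y))
    open Linear public

    id-linear : ∀ {a} → Linear {a} (λ x → x)
    id-linear = record { +-hom = λ _ _ → refl ; ·-hom = λ _ _ → refl }

    ∘-linear : ∀ {a b c} {L : V b → V c} {M : V a → V b} → Linear L → Linear M → Linear (λ x → L (M x))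
    ∘-linear {L = L} linL linM = record
      { +-hom = λ x y → trans (cong L (+-hom linM x y)) (+-hom linL _ _)
      ; ·-hom = λ c x → trans (cong L (·-hom linM c x)) (·-hom linL c _) }

    ^-linear : ∀ {a} {L : V a → V a} → Linear L → ∀ m → Linear (L ^ m)
    ^-linear linL zero    = id-linear
    ^-linear linL (suc m) = ∘-linear linL (^-linear linL m)

    difference-linear : ∀ {a b} {L M : V a → V b} → Linear L → Linear M → Linear (λ x → L x -V M x)
    difference-linear {L = L} {M} linL linM = record
      { +-hom = λ x y → begin
          L (x +V y) -V M (x +V y)
            ≡⟨ cong₂ _-V_ (+-hom linL x y) (+-hom linM x y) ⟩
          (L x +V L y) +V ((- 1#) ·V (M x +V M y))
            ≡⟨ cong ((L x +V L y) +V_) (·V-distribˡ (- 1#) (M x) (M y)) ⟩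
          (L x +V L y) +V (((- 1#) ·V M x) +V ((- 1#) ·V M y))
            ≡⟨ +V-interchange (L x) (L y) _ _ ⟩
          (L x -V M x) +V (L y -V M y) ∎
      ; ·-hom = λ c x → begin
          L (c ·V x) -V M (c ·V x)
            ≡⟨ cong₂ _-V_ (·-hom linL c x) (·-hom linM c x) ⟩
          (c ·V L x) +V ((- 1#) ·V (c ·V M x))
            ≡⟨ cong (λ v → (c ·V L x) +V v) (trans (·V-assoc (- 1#) c (M x))
                 (trans (cong (_·V M x) (*-comm (- 1#) c)) (sym (·V-assoc c (- 1#) (M x))))) ⟩
          (c ·V L x) +V (c ·V ((- 1#) ·V M x))
            ≡⟨ sym (·V-distribˡ c (L x) _) ⟩
          c ·V (L x -V M x) ∎ }
      where open ≡-Reasoning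

    lincomb-linear : ∀ {a d} (bs : Vec (V a) d) → Linear (λ c → lincomb c bs)
    lincomb-linear bs = record { +-hom = λ c c′ → plus c c′ bs ; ·-hom = λ s c → scale s c bs }
      where
      plus : ∀ {a d} (c c′ : Vec Carrier d) (bs : Vec (V a) d) →
             lincomb (c +V c′) bs ≡ lincomb c bs +V lincomb c′ bs
      plus []       []         []       = sym (+V-identityˡ 0V)
      plus (c ∷ cs) (c′ ∷ cs′) (b ∷ bs) =
        trans (cong₂ _+V_ (·V-distribʳ c c′ b) (plus cs cs′ bs)) (+V-interchange _ _ _ _)
      scale : ∀ {a d} s (c : Vec Carrier d) (bs : Vec (V a) d) → lincomb (s ·V c) bs ≡ s ·V lincomb c bs
      scale s []       []       = sym (·V-zeroʳ s)
      scale s (c ∷ cs) (b ∷ bs) =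
        trans (cong₂ _+V_ (sym (·V-assoc s c b)) (scale s cs bs)) (sym (·V-distribˡ s _ _))

    lincomb-map : ∀ {a b d} {L : V a → V b} → Linear L → (c : Vec Carrier d) (bs : Vec (V a) d) →
                  L (lincomb c bs) ≡ lincomb c (map L bs)
    lincomb-map linL []       []       = 0-hom linL
    lincomb-map linL (c ∷ cs) (b ∷ bs) =
      trans (+-hom linL _ _) (cong₂ _+V_ (·-hom linL c b) (lincomb-map linL cs bs))

    lincomb-++ : ∀ {a d e} (c : Vec Carrier d) (c′ : Vec Carrier e) (bs : Vec (V a) d) (bs′ : Vec (V a) e) →
                 lincomb (c ++ c′) (bs ++ bs′) ≡ lincomb c bs +V lincomb c′ bs′
    lincomb-++ []       c′ []       bs′ = sym (+V-identityˡ _)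
    lincomb-++ (c ∷ cs) c′ (b ∷ bs) bs′ =
      trans (cong ((c ·V b) +V_) (lincomb-++ cs c′ bs bs′)) (sym (+V-assoc _ _ _))

    lincomb-mem : ∀ {a d} {U : V a → Set} → IsSubspace U → (c : Vec Carrier d) (bs : Vec (V a) d) →
                  (∀ k → U (lookup bs k)) → U (lincomb c bs)
    lincomb-mem U-sub []       []       _     = IsSubspace.zero-mem U-sub
    lincomb-mem U-sub (c ∷ cs) (b ∷ bs) in-U =
      IsSubspace.+-mem U-sub (IsSubspace.·-mem U-sub c (in-U Fin.zero)) (lincomb-mem U-sub cs bs (λ k → in-U (Fin.suc k)))

    kernel-subspace : ∀ {a b} {L : V a → V b} → Linear L → IsSubspace (λ x → L x ≡ 0V)
    kernel-subspace linL = record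
      { zero-mem = 0-hom linL
      ; +-mem    = λ Lx≡0 Ly≡0 → trans (+-hom linL _ _) (trans (cong₂ _+V_ Lx≡0 Ly≡0) (+V-identityˡ 0V))
      ; ·-mem    = λ c Lx≡0 → trans (·-hom linL c _) (trans (cong (c ·V_) Lx≡0) (·V-zeroʳ c)) }

    preimage-subspace : ∀ {a b c e} {K : V a → V b} {L : V a → V c} {Φ : V e → V c} {U : V a → Set} →
                        Linear K → Linear L → Linear Φ → IsSubspace U →
                        IsSubspace (λ y → ∃[ x ] (U x × K x ≡ 0V × L x ≡ Φ y))
    preimage-subspace {K = K} {L} {Φ} linK linL linΦ U-sub = record
      { zero-mem = 0V , zero-mem , 0-hom linK , trans (0-hom linL) (sym (0-hom linΦ))
      ; +-mem    = λ { {y} {y′} (x , x∈U , Kx≡0 , Lx≡Φy) (x′ , x′∈U , Kx′≡0 , Lx′≡Φy′) →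
                       x +V x′ , +-mem x∈U x′∈U
                     , trans (+-hom linK x x′) (trans (cong₂ _+V_ Kx≡0 Kx′≡0) (+V-identityˡ 0V))
                     , trans (+-hom linL x x′) (trans (cong₂ _+V_ Lx≡Φy Lx′≡Φy′) (sym (+-hom linΦ y y′))) }
      ; ·-mem    = λ { s {y} (x , x∈U , Kx≡0 , Lx≡Φy) →
                       s ·V x , ·-mem s x∈U
                     , trans (·-hom linK s x) (trans (cong (s ·V_) Kx≡0) (·V-zeroʳ s))
                     , trans (·-hom linL s x) (trans (cong (s ·V_) Lx≡Φy) (sym (·-hom linΦ s y))) } }
      where open IsSubspace U-sub

  module Dimension where
    open Vectors
    open LinearMaps
    open Scalars using (_≟_)

    Independent : ∀ {a d} → Vec (V a) d → Set
    Independent bs = ∀ c → lincomb c bs ≡ 0V → ∀ k → lookup c k ≡ 0#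

    lincomb-injective : ∀ {a d} {bs : Vec (V a) d} → Independent bs → Injective _≡_ _≡_ (λ c → lincomb c bs)
    lincomb-injective {bs = bs} indep {c} {c′} same = -V≡0⇒≡ c c′ (vext λ k →
      trans (indep (c -V c′) difference-vanishes k) (sym (lookup-0V k)))
      where
      difference-vanishes : lincomb (c -V c′) bs ≡ 0V
      difference-vanishes = trans (-‿hom (lincomb-linear bs) c c′)
                              (trans (cong (_-V lincomb c′ bs) same) (-V-self _))

    vectors↔ : ∀ m → V m ↔ Fin (q Nat.^ m)
    vectors↔ m = ↔-trans (↔-sym (↔Vec m)) (↔-trans (lift↔ m card) (↔-sym (Fin[m^n]↔Fin[m]^n q m)))

    module Count (m : ℕ) = Inverse (vectors↔ m)

    1<q : 1 Nat.< q
    1<q = FinP.injective⇒≤ {f = zero-one} zero-one-injective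
      where
      zero-one : Fin 2 → Fin q
      zero-one Fin.zero    = to 0#
      zero-one (Fin.suc _) = to 1#
      0≢1′ : to 0# ≢ to 1#
      0≢1′ e = 0≢1 (trans (sym (strictlyInverseʳ 0#)) (trans (cong from e) (strictlyInverseʳ 1#)))
      zero-one-injective : Injective _≡_ _≡_ zero-one
      zero-one-injective {Fin.zero}          {Fin.zero}          _ = refl
      zero-one-injective {Fin.zero}          {Fin.suc Fin.zero}  e = ⊥-elim (0≢1′ e)
      zero-one-injective {Fin.suc Fin.zero}  {Fin.zero}          e = ⊥-elim (0≢1′ (sym e))
      zero-one-injective {Fin.suc Fin.zero}  {Fin.suc Fin.zero}  _ = refl

    -- An independent family in F^a has at most a members: its q^d linear
    -- combinations are distinct elements of F^a.
    independent-bound : ∀ {a d} (bs : Vec (V a) d) → Independent bs → d Nat.≤ a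
    independent-bound {a} {d} bs indep =
      ℕP.≮⇒≥ (λ a<d → ℕP.<⇒≱ (ℕP.^-monoʳ-< q 1<q a<d) (FinP.injective⇒≤ combinations-injective))
      where
      combinations : Fin (q Nat.^ d) → Fin (q Nat.^ a)
      combinations i = Count.to a (lincomb (Count.from d i) bs)
      combinations-injective : Injective _≡_ _≡_ combinations
      combinations-injective e = Injection.injective (↔⇒↣ (↔-sym (vectors↔ d)))
        (lincomb-injective indep (Injection.injective (↔⇒↣ (vectors↔ a)) e))

    -- An independent family lying in the span of d vectors has at most d members:
    -- its coordinate vectors form an independent family in F^d.
    independent-in-span : ∀ {a d m} (bs : Vec (V a) d) (xs : Vec (V a) m) → Independent xs →
                          (∀ k → ∃[ c ] (lookup xs k ≡ lincomb c bs)) → m Nat.≤ d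
    independent-in-span {d = d} {m} bs xs indep coords = independent-bound cs cs-independent
      where
      cs : Vec (V d) m
      cs = Vec.tabulate (λ k → proj₁ (coords k))
      xs≡ : xs ≡ map (λ c → lincomb c bs) cs
      xs≡ = vext λ k → trans (proj₂ (coords k)) (sym (trans (VecP.lookup-map k _ cs)
                              (cong (λ c → lincomb c bs) (VecP.lookup∘tabulate _ k))))
      cs-independent : Independent cs
      cs-independent a e = indep a (begin
        lincomb a xs                                   ≡⟨ cong (lincomb a) xs≡ ⟩
        lincomb a (map (λ c → lincomb c bs) cs)        ≡⟨ sym (lincomb-map (lincomb-linear bs) a cs) ⟩
        lincomb (lincomb a cs) bs                      ≡⟨ cong (λ c → lincomb c bs) e ⟩
        lincomb 0V bs                                  ≡⟨ 0-hom (lincomb-linear bs) ⟩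
        0V                                             ∎)
        where open ≡-Reasoning

    ++-every : ∀ {A : Set} {P : A → Set} {a b} (xs : Vec A a) (ys : Vec A b) →
               (∀ k → P (lookup xs k)) → (∀ k → P (lookup ys k)) → ∀ k → P (lookup (xs ++ ys) k)
    ++-every []       ys _   Pys k           = Pys k
    ++-every (x ∷ xs) ys Pxs Pys Fin.zero    = Pxs Fin.zero
    ++-every {P = P} (x ∷ xs) ys Pxs Pys (Fin.suc k) = ++-every {P = P} xs ys (λ k → Pxs (Fin.suc k)) Pys k

    independent-++ : ∀ {a b m k} {L : V a → V b} → Linear L → (xs : Vec (V a) m) (ys : Vec (V a) k) →
                     (∀ c → L (lincomb c xs) ≡ 0V → ∀ j → lookup c j ≡ 0#) →
                     (∀ j → L (lookup ys j) ≡ 0V) → Independent ys → Independent (xs ++ ys)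
    independent-++ {a} {m = m} {L = L} linL xs ys L-xs-independent L-kills-ys ys-independent c combination≡0
      with Vec.splitAt m c
    ... | c₁ , c₂ , refl = ++-every {P = _≡ 0#} c₁ c₂ c₁≡0 (ys-independent c₂ w₂≡0)
      where
      open ≡-Reasoning
      w₁ w₂ : V a
      w₁ = lincomb c₁ xs
      w₂ = lincomb c₂ ys
      w₁+w₂≡0 : w₁ +V w₂ ≡ 0V
      w₁+w₂≡0 = trans (sym (lincomb-++ c₁ c₂ xs ys)) combination≡0
      Lw₂≡0 : L w₂ ≡ 0V
      Lw₂≡0 = lincomb-mem (kernel-subspace linL) c₂ ys L-kills-ys
      Lw₁≡0 : L w₁ ≡ 0V
      Lw₁≡0 = begin
        L w₁            ≡⟨ sym (+V-identityʳ _) ⟩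
        L w₁ +V 0V      ≡⟨ cong (L w₁ +V_) (sym Lw₂≡0) ⟩
        L w₁ +V L w₂    ≡⟨ sym (+-hom linL w₁ w₂) ⟩
        L (w₁ +V w₂)    ≡⟨ cong L w₁+w₂≡0 ⟩
        L 0V            ≡⟨ 0-hom linL ⟩
        0V              ∎
      c₁≡0 : ∀ j → lookup c₁ j ≡ 0#
      c₁≡0 = L-xs-independent c₁ Lw₁≡0
      w₂≡0 : w₂ ≡ 0V
      w₂≡0 = begin
        w₂              ≡⟨ sym (+V-identityˡ w₂) ⟩
        0V +V w₂        ≡⟨ cong (_+V w₂) (sym w₁≡0) ⟩
        w₁ +V w₂        ≡⟨ w₁+w₂≡0 ⟩
        0V              ∎
        where
        w₁≡0 : w₁ ≡ 0V
        w₁≡0 = trans (cong (λ c → lincomb c xs) (vext {x = c₁} {y = 0V} λ j → trans (c₁≡0 j) (sym (lookup-0V j))))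
                     (0-hom (lincomb-linear xs))

    any-vector? : ∀ {m} {P : V m → Set} → (∀ x → Dec (P x)) → Dec (∃ P)
    any-vector? {m} {P} P? = map′ (λ (i , p) → Count.from m i , p)
      (λ (x , p) → Count.to m x , subst P (sym (Count.strictlyInverseʳ m x)) p)
      (FinP.any? (λ i → P? (Count.from m i)))

    InSpan : ∀ {a d} → Vec (V a) d → V a → Set
    InSpan bs x = ∃[ c ] (x ≡ lincomb c bs)

    inSpan? : ∀ {a d} (bs : Vec (V a) d) x → Dec (InSpan bs x)
    inSpan? bs x = any-vector? (λ c → VecP.≡-dec _≟_ x (lincomb c bs))

    independent-extend : ∀ {a d} (bs : Vec (V a) d) x → Independent bs → ¬ InSpan bs x → Independent (x ∷ bs)
    independent-extend bs x indep x∉ (c₀ ∷ cs) e with c₀ ≟ 0#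
    ... | yes c₀≡0 = λ { Fin.zero → c₀≡0 ; (Fin.suc k) → indep cs rest-vanishes k }
      where
      rest-vanishes : lincomb cs bs ≡ 0V
      rest-vanishes = begin
        lincomb cs bs                     ≡⟨ sym (+V-identityˡ _) ⟩
        0V +V lincomb cs bs
          ≡⟨ cong (_+V lincomb cs bs) (sym (trans (cong (_·V x) c₀≡0) (·V-zeroˡ x))) ⟩
        (c₀ ·V x) +V lincomb cs bs        ≡⟨ e ⟩
        0V                                ∎
        where open ≡-Reasoning
    ... | no c₀≢0 = ⊥-elim (x∉ ((c₀⁻¹ * (- 1#)) ·V cs , x≡))
      where
      open ≡-Reasoning
      c₀⁻¹ : Carrier
      c₀⁻¹ = proj₁ (inverse c₀ c₀≢0)
      c₀c₀⁻¹≡1 : c₀ * c₀⁻¹ ≡ 1#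
      c₀c₀⁻¹≡1 = proj₂ (inverse c₀ c₀≢0)
      x≡ : x ≡ lincomb ((c₀⁻¹ * (- 1#)) ·V cs) bs
      x≡ = begin
        x                                     ≡⟨ sym (·V-identity x) ⟩
        1# ·V x                               ≡⟨ cong (_·V x) (sym (trans (*-comm c₀⁻¹ c₀) c₀c₀⁻¹≡1)) ⟩
        (c₀⁻¹ * c₀) ·V x                      ≡⟨ sym (·V-assoc c₀⁻¹ c₀ x) ⟩
        c₀⁻¹ ·V (c₀ ·V x)                     ≡⟨ cong (c₀⁻¹ ·V_) (+V≡0⇒≡neg _ _ e) ⟩
        c₀⁻¹ ·V ((- 1#) ·V lincomb cs bs)     ≡⟨ ·V-assoc c₀⁻¹ (- 1#) _ ⟩
        (c₀⁻¹ * (- 1#)) ·V lincomb cs bs      ≡⟨ sym (·-hom (lincomb-linear bs) _ cs) ⟩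
        lincomb ((c₀⁻¹ * (- 1#)) ·V cs) bs    ∎

    -- Every decidable set P of vectors is spanned by an independent family of its own
    -- members: extend greedily while some member of P lies outside the span.  This
    -- stops after at most a+1 steps by independent-bound.
    basis-exists : ∀ {a} (P : V a → Set) → (∀ x → Dec (P x)) → ∃[ e ] HasDim P e
    basis-exists {a} P P? = extend 0 [] (λ _ _ ()) (λ ()) (suc a) refl
      where
      extend : ∀ m (bs : Vec (V a) m) → Independent bs → (∀ k → P (lookup bs k)) →
               ∀ fuel → m Nat.+ fuel ≡ suc a → ∃[ e ] HasDim P e
      extend m bs indep in-P zero m+0≡1+a =
        ⊥-elim (ℕP.<-irrefl (trans (sym (ℕP.+-identityʳ m)) m+0≡1+a) (s≤s (independent-bound bs indep)))
      extend m bs indep in-P (suc fuel) m+fuel≡1+a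
        with any-vector? (λ x → P? x ×-dec ¬? (inSpan? bs x))
      ... | yes (x , x∈P , x∉) =
            extend (suc m) (x ∷ bs) (independent-extend bs x indep x∉)
              (λ { Fin.zero → x∈P ; (Fin.suc k) → in-P k }) fuel (trans (sym (ℕP.+-suc m fuel)) m+fuel≡1+a)
      ... | no none = m , bs , record { in-U = in-P ; independent = indep ; spanning = spans }
        where
        spans : ∀ x → P x → InSpan bs x
        spans x x∈P with inSpan? bs x
        ... | yes s  = s
        ... | no  x∉ = ⊥-elim (none (x , x∈P , x∉))

  module Shift where
    open Vectors
    open LinearMaps

    σ^≡σ^ : ∀ {N} m (x : V N) → σ^ m x ≡ (σ ^ m) x
    σ^≡σ^ zero    x = refl
    σ^≡σ^ (suc m) x = cong σ (σ^≡σ^ m x)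

    lookup-σ : ∀ {N} (x : V N) i → lookup (σ x) i ≡ lookup x (predMod i)
    lookup-σ x i = VecP.lookup∘tabulate (λ j → lookup x (predMod j)) i

    lookup-σ^ : ∀ {N} m (x : V N) i → lookup ((σ ^ m) x) i ≡ lookup x ((predMod ^ m) i)
    lookup-σ^ zero    x i = refl
    lookup-σ^ (suc m) x i = trans (lookup-σ ((σ ^ m) x) i)
      (trans (lookup-σ^ m x (predMod i)) (cong (lookup x) (sym (^-intertwine {f = predMod} (λ _ → refl) m i))))

    σ-linear : ∀ {N} → Linear (σ {N})
    σ-linear = record
      { +-hom = λ x y → vext λ i → trans (lookup-σ (x +V y) i) (trans (lookup-+V x y (predMod i))
                  (sym (trans (lookup-+V (σ x) (σ y) i) (cong₂ _+_ (lookup-σ x i) (lookup-σ y i)))))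
      ; ·-hom = λ c x → vext λ i → trans (lookup-σ (c ·V x) i) (trans (lookup-·V c x (predMod i))
                  (sym (trans (lookup-·V c (σ x) i) (cong (c *_) (lookup-σ x i))))) }

    predMod-suc : ∀ {N} t (i : Fin N) → toℕ i ≡ suc t → toℕ (predMod i) ≡ t
    predMod-suc {suc M} t (Fin.suc i) i≡ = trans (FinP.toℕ-inject₁ i) (ℕP.suc-injective i≡)

    predMod^-below : ∀ {N} m t (i : Fin N) → toℕ i ≡ m Nat.+ t → toℕ ((predMod ^ m) i) ≡ t
    predMod^-below zero    t i i≡ = i≡
    predMod^-below (suc m) t i i≡ =
      predMod-suc t ((predMod ^ m) i) (predMod^-below m (suc t) i (trans i≡ (sym (ℕP.+-suc m t))))

    predMod^-wrap : ∀ {M} t s u (i : Fin (suc M)) → toℕ i ≡ t → M ≡ s Nat.+ u →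
                    toℕ ((predMod ^ (s Nat.+ suc t)) i) ≡ u
    predMod^-wrap {M} t s u i i≡t M≡s+u =
      trans (cong toℕ (^-add predMod s (suc t) i)) (predMod^-below s u _ wrapped)
      where
      at-zero : (predMod ^ t) i ≡ Fin.zero
      at-zero = FinP.toℕ-injective (predMod^-below t 0 i (trans i≡t (sym (ℕP.+-identityʳ t))))
      wrapped : toℕ (predMod ((predMod ^ t) i)) ≡ s Nat.+ u
      wrapped = trans (cong (λ j → toℕ (predMod {suc M} j)) at-zero) (trans (FinP.toℕ-fromℕ M) M≡s+u)

    predMod^-period : ∀ {N} (i : Fin N) → (predMod ^ N) i ≡ i
    predMod^-period {suc M} i = FinP.toℕ-injective
      (subst (λ m → toℕ ((predMod ^ m) i) ≡ toℕ i) s+1+t≡N (predMod^-wrap t s t i refl (sym s+t≡M)))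
      where
      t s : ℕ
      t = toℕ i
      s = M Nat.∸ t
      s+t≡M : s Nat.+ t ≡ M
      s+t≡M = ℕP.m∸n+n≡m (ℕP.≤-pred (FinP.toℕ<n i))
      s+1+t≡N : s Nat.+ suc t ≡ suc M
      s+1+t≡N = trans (ℕP.+-suc s t) (cong suc s+t≡M)

    σ-period : ∀ {N} (x : V N) → (σ ^ N) x ≡ x
    σ-period {N} x = vext λ i → trans (lookup-σ^ N x i) (cong (lookup x) (predMod^-period i))

    σ-period-multiple : ∀ {N} j (x : V N) → (σ ^ (j Nat.* N)) x ≡ x
    σ-period-multiple zero        x = refl
    σ-period-multiple {N} (suc j) x =
      trans (^-add σ N (j Nat.* N) x) (trans (cong (σ ^ N) (σ-period-multiple j x)) (σ-period x))

    σ^-comm : ∀ {N} a b (x : V N) → (σ ^ a) ((σ ^ b) x) ≡ (σ ^ b) ((σ ^ a) x)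
    σ^-comm a b x = trans (sym (^-add σ a b x))
      (trans (cong (λ m → (σ ^ m) x) (ℕP.+-comm a b)) (^-add σ b a x))

    σ-undo : ∀ {N} i → i Nat.≤ N → (x : V N) → (σ ^ (N Nat.∸ i)) ((σ ^ i) x) ≡ x
    σ-undo {N} i i≤N x =
      trans (sym (^-add σ (N Nat.∸ i) i x)) (trans (cong (λ m → (σ ^ m) x) (ℕP.m∸n+n≡m i≤N)) (σ-period x))

  module Sums {N : ℕ} where
    open Vectors
    open LinearMaps

    ΣV : ℕ → (ℕ → V N) → V N
    ΣV zero    f = 0V
    ΣV (suc k) f = f 0 +V ΣV k (λ j → f (suc j))

    ΣV-map : ∀ {L : V N → V N} → Linear L → ∀ k f → L (ΣV k f) ≡ ΣV k (λ j → L (f j))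
    ΣV-map linL zero    f = 0-hom linL
    ΣV-map linL (suc k) f = trans (+-hom linL _ _) (cong (_ +V_) (ΣV-map linL k _))

    ΣV-cong : ∀ k f g → (∀ j → j Nat.< k → f j ≡ g j) → ΣV k f ≡ ΣV k g
    ΣV-cong zero    f g f≡g = refl
    ΣV-cong (suc k) f g f≡g = cong₂ _+V_ (f≡g 0 (s≤s z≤n)) (ΣV-cong k _ _ (λ j j<k → f≡g (suc j) (s≤s j<k)))

    ΣV-difference : ∀ k f g → ΣV k (λ j → f j -V g j) ≡ ΣV k f -V ΣV k g
    ΣV-difference zero    f g = sym (-V-self 0V)
    ΣV-difference (suc k) f g = begin
      (f 0 -V g 0) +V ΣV k (λ j → f (suc j) -V g (suc j))
        ≡⟨ cong ((f 0 -V g 0) +V_) (ΣV-difference k _ _) ⟩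
      (f 0 -V g 0) +V (ΣV k (λ j → f (suc j)) -V ΣV k (λ j → g (suc j)))
        ≡⟨ +V-interchange (f 0) _ _ _ ⟩
      (f 0 +V ΣV k (λ j → f (suc j))) +V (((- 1#) ·V g 0) +V ((- 1#) ·V ΣV k (λ j → g (suc j))))
        ≡⟨ cong (_ +V_) (sym (·V-distribˡ (- 1#) (g 0) _)) ⟩
      ΣV (suc k) f -V ΣV (suc k) g ∎
      where open ≡-Reasoning

    ΣV-last : ∀ k f → ΣV (suc k) f ≡ ΣV k f +V f k
    ΣV-last zero    f = trans (+V-identityʳ _) (sym (+V-identityˡ _))
    ΣV-last (suc k) f = trans (cong (f 0 +V_) (ΣV-last k _)) (sym (+V-assoc _ _ _))

    ΣV-zero : ∀ k f → (∀ j → j Nat.< k → f j ≡ 0V) → ΣV k f ≡ 0V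
    ΣV-zero k f f≡0 = trans (ΣV-cong k f (λ _ → 0V) f≡0) (zeros k)
      where
      zeros : ∀ k → ΣV k (λ _ → 0V) ≡ 0V
      zeros zero    = refl
      zeros (suc k) = trans (+V-identityˡ _) (zeros k)

  module Binomial {N : ℕ} (A : V N → V N) (A-linear : LinearMaps.Linear A) where
    open Vectors
    open LinearMaps
    open Sums {N}

    T : V N → V N
    T v = A v -V v

    T-linear : Linear T
    T-linear = difference-linear A-linear id-linear

    coefficient : ℕ → ℕ → Carrier
    coefficient m j = (m C j) ⊗ ((- 1#) ^ᶠ (m Nat.∸ j))

    term : ℕ → V N → ℕ → V N
    term m v j = coefficient m j ·V (A ^ j) v

    coefficient-pascal : ∀ m j → coefficient (suc m) (suc j) ≡ coefficient m j + (- 1#) * coefficient m (suc j)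
    coefficient-pascal m j = begin
      (suc m C suc j) ⊗ s
        ≡⟨ cong (_⊗ s) (sym (nCk+nC[k+1]≡[n+1]C[k+1] m j)) ⟩
      (m C j Nat.+ m C suc j) ⊗ s
        ≡⟨ ×-homo-+ s (m C j) (m C suc j) ⟩
      coefficient m j + (m C suc j) ⊗ s
        ≡⟨ cong (coefficient m j +_) (lower-sign (j ℕP.<? m)) ⟩
      coefficient m j + (- 1#) * coefficient m (suc j) ∎
      where
      open ≡-Reasoning
      s : Carrier
      s = (- 1#) ^ᶠ (m Nat.∸ j)
      lower-sign : Dec (j Nat.< m) → (m C suc j) ⊗ s ≡ (- 1#) * coefficient m (suc j)
      lower-sign (yes j<m) = begin
        (m C suc j) ⊗ s
          ≡⟨ cong (λ e → (m C suc j) ⊗ ((- 1#) ^ᶠ e)) (ℕP.+-∸-assoc 1 j<m) ⟩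
        (m C suc j) ⊗ ((- 1#) * (- 1#) ^ᶠ (m Nat.∸ suc j))
          ≡⟨ sym (×-comm-* (m C suc j) (- 1#) _) ⟩
        (- 1#) * coefficient m (suc j) ∎
      lower-sign (no j≮m) = begin
        (m C suc j) ⊗ s                 ≡⟨ cong (_⊗ s) m-choose ⟩
        0#                              ≡⟨ sym (zeroʳ (- 1#)) ⟩
        (- 1#) * 0#                     ≡⟨ cong (λ c → (- 1#) * (c ⊗ ((- 1#) ^ᶠ (m Nat.∸ suc j)))) (sym m-choose) ⟩
        (- 1#) * coefficient m (suc j)  ∎
        where
        m-choose : m C suc j ≡ 0
        m-choose = k>n⇒nCk≡0 (s≤s (ℕP.≮⇒≥ j≮m))

    T-term : ∀ m v j → T (term m v j) ≡ coefficient m j ·V (A ^ suc j) v -V term m v j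
    T-term m v j = cong (_-V term m v j) (·-hom A-linear (coefficient m j) ((A ^ j) v))

    -- The top coefficient vanishes, so a sum of terms may be extended by one.
    extend-sum : ∀ m v → ΣV (suc (suc m)) (term m v) ≡ ΣV (suc m) (term m v)
    extend-sum m v = begin
      ΣV (suc (suc m)) (term m v)        ≡⟨ ΣV-last (suc m) (term m v) ⟩
      ΣV (suc m) (term m v) +V term m v (suc m)
        ≡⟨ cong (λ c → ΣV (suc m) (term m v) +V ((c ⊗ ((- 1#) ^ᶠ (m Nat.∸ suc m))) ·V (A ^ suc m) v))
                (k>n⇒nCk≡0 (ℕP.n<1+n m)) ⟩
      ΣV (suc m) (term m v) +V (0# ·V (A ^ suc m) v) ≡⟨ cong (ΣV (suc m) (term m v) +V_) (·V-zeroˡ _) ⟩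
      ΣV (suc m) (term m v) +V 0V        ≡⟨ +V-identityʳ _ ⟩
      ΣV (suc m) (term m v)              ∎
      where open ≡-Reasoning

    expansion : ∀ m v → (T ^ m) v ≡ ΣV (suc m) (term m v)
    expansion zero    v = sym (trans (+V-identityʳ _) (trans (cong (_·V v) (+-identityʳ 1#)) (·V-identity v)))
    expansion (suc m) v = begin
      T ((T ^ m) v)
        ≡⟨ cong T (expansion m v) ⟩
      T (ΣV (suc m) (term m v))
        ≡⟨ ΣV-map T-linear (suc m) (term m v) ⟩
      ΣV (suc m) (λ j → T (term m v j))
        ≡⟨ ΣV-cong (suc m) _ _ (λ j _ → T-term m v j) ⟩
      ΣV (suc m) (λ j → raised j -V term m v j)
        ≡⟨ ΣV-difference (suc m) raised (term m v) ⟩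
      ΣV (suc m) raised -V ΣV (suc m) (term m v)
        ≡⟨ cong (ΣV (suc m) raised -V_) (sym (extend-sum m v)) ⟩
      ΣV (suc m) raised +V ((- 1#) ·V (term m v 0 +V ΣV (suc m) (λ j → term m v (suc j))))
        ≡⟨ cong (ΣV (suc m) raised +V_) (·V-distribˡ (- 1#) (term m v 0) _) ⟩
      ΣV (suc m) raised +V (((- 1#) ·V term m v 0) +V ((- 1#) ·V ΣV (suc m) (λ j → term m v (suc j))))
        ≡⟨ +V-swap (ΣV (suc m) raised) _ _ ⟩
      ((- 1#) ·V term m v 0) +V (ΣV (suc m) raised -V ΣV (suc m) (λ j → term m v (suc j)))
        ≡⟨ cong₂ _+V_ first-term (sym (ΣV-difference (suc m) raised (λ j → term m v (suc j)))) ⟩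
      term (suc m) v 0 +V ΣV (suc m) (λ j → raised j -V term m v (suc j))
        ≡⟨ cong (term (suc m) v 0 +V_) (ΣV-cong (suc m) _ _ (λ j _ → sym (pascal-term j))) ⟩
      ΣV (suc (suc m)) (term (suc m) v) ∎
      where
      open ≡-Reasoning
      raised : ℕ → V N
      raised j = coefficient m j ·V (A ^ suc j) v
      first-term : (- 1#) ·V term m v 0 ≡ term (suc m) v 0
      first-term = trans (·V-assoc (- 1#) _ v) (cong (_·V v) (×-comm-* 1 (- 1#) _))
      pascal-term : ∀ j → term (suc m) v (suc j) ≡ raised j -V term m v (suc j)
      pascal-term j = begin
        coefficient (suc m) (suc j) ·V (A ^ suc j) v
          ≡⟨ cong (_·V (A ^ suc j) v) (coefficient-pascal m j) ⟩
        (coefficient m j + (- 1#) * coefficient m (suc j)) ·V (A ^ suc j) v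
          ≡⟨ ·V-distribʳ _ _ _ ⟩
        raised j +V (((- 1#) * coefficient m (suc j)) ·V (A ^ suc j) v)
          ≡⟨ cong (raised j +V_) (sym (·V-assoc (- 1#) _ _)) ⟩
        raised j -V term m v (suc j) ∎

    -- In characteristic p the inner binomial coefficients vanish:  T^p v = (−1)^p v + A^p v.
    frobenius : ∀ p′ → Prime (suc p′) → suc p′ ⊗ 1# ≡ 0# → ∀ v →
                (T ^ suc p′) v ≡ (((- 1#) ^ᶠ suc p′) ·V v) +V (A ^ suc p′) v
    frobenius p′ p-prime char v = begin
      (T ^ p) v
        ≡⟨ expansion p v ⟩
      term p v 0 +V ΣV p (λ j → term p v (suc j))
        ≡⟨ cong (term p v 0 +V_) (ΣV-last p′ (λ j → term p v (suc j))) ⟩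
      term p v 0 +V (ΣV p′ (λ j → term p v (suc j)) +V term p v p)
        ≡⟨ cong (λ w → term p v 0 +V (w +V term p v p)) (ΣV-zero p′ _ inner-terms-vanish) ⟩
      term p v 0 +V (0V +V term p v p)
        ≡⟨ cong₂ _+V_ first-term (trans (+V-identityˡ _) last-term) ⟩
      (((- 1#) ^ᶠ p) ·V v) +V (A ^ p) v ∎
      where
      open ≡-Reasoning
      p : ℕ
      p = suc p′
      inner-terms-vanish : ∀ j → j Nat.< p′ → term p v (suc j) ≡ 0V
      inner-terms-vanish j j<p′ =
        trans (cong (_·V (A ^ suc j) v)
                (Scalars.char-multiple char (prime∣binomial (suc j) p-prime (s≤s z≤n) (s≤s j<p′)) _))
              (·V-zeroˡ _)
      first-term : term p v 0 ≡ ((- 1#) ^ᶠ p) ·V v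
      first-term = cong (_·V v) (+-identityʳ _)
      last-term : term p v p ≡ (A ^ p) v
      last-term = begin
        ((p C p) ⊗ ((- 1#) ^ᶠ (p Nat.∸ p))) ·V (A ^ p) v
          ≡⟨ cong₂ (λ c e → (c ⊗ ((- 1#) ^ᶠ e)) ·V (A ^ p) v) (nCn≡1 p) (ℕP.n∸n≡0 p) ⟩
        (1# + 0#) ·V (A ^ p) v    ≡⟨ cong (_·V (A ^ p) v) (+-identityʳ 1#) ⟩
        1# ·V (A ^ p) v           ≡⟨ ·V-identity _ ⟩
        (A ^ p) v                 ∎

    nilpotent : ∀ p′ → Prime (suc p′) → suc p′ ⊗ 1# ≡ 0# → (- 1#) ^ᶠ suc p′ + 1# ≡ 0# →
                (∀ v → (A ^ suc p′) v ≡ v) → ∀ v → (T ^ suc p′) v ≡ 0V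
    nilpotent p′ p-prime char sign period v = begin
      (T ^ p) v                             ≡⟨ frobenius p′ p-prime char v ⟩
      (((- 1#) ^ᶠ p) ·V v) +V (A ^ p) v
        ≡⟨ cong ((((- 1#) ^ᶠ p) ·V v) +V_) (trans (period v) (sym (·V-identity v))) ⟩
      (((- 1#) ^ᶠ p) ·V v) +V (1# ·V v)       ≡⟨ sym (·V-distribʳ _ 1# v) ⟩
      ((- 1#) ^ᶠ p + 1#) ·V v               ≡⟨ cong (_·V v) sign ⟩
      0# ·V v                               ≡⟨ ·V-zeroˡ v ⟩
      0V                                    ∎
      where
      open ≡-Reasoning
      p : ℕ
      p = suc p′

  -- (−1)^p = −1 in characteristic p: expanding (1 − 1)^p, i.e. taking A = 1, gives 0 = (−1)^p + 1.
  sign-char : ∀ p′ → Prime (suc p′) → suc p′ ⊗ 1# ≡ 0# → (- 1#) ^ᶠ suc p′ + 1# ≡ 0#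
  sign-char p′ p-prime char = begin
    (- 1#) ^ᶠ p + 1#           ≡⟨ cong (_+ 1#) (sym (*-identityʳ _)) ⟩
    lookup ((((- 1#) ^ᶠ p) ·V e) +V e) Fin.zero
      ≡⟨ cong (λ w → lookup ((((- 1#) ^ᶠ p) ·V e) +V w) Fin.zero) (sym (^-identity p e)) ⟩
    lookup ((((- 1#) ^ᶠ p) ·V e) +V ((λ x → x) ^ p) e) Fin.zero
      ≡⟨ cong (λ w → lookup w Fin.zero) (sym (frobenius p′ p-prime char e)) ⟩
    lookup ((T ^ p) e) Fin.zero
      ≡⟨ cong (λ w → lookup w Fin.zero) (T-vanishes p′) ⟩
    0#                         ∎
    where
    open ≡-Reasoning
    open Vectors
    open LinearMaps
    open Binomial {1} (λ x → x) id-linear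
    p : ℕ
    p = suc p′
    e : V 1
    e = 1# ∷ []
    T-vanishes : ∀ m → (T ^ suc m) e ≡ 0V
    T-vanishes m = -V-self _

  -- The block structure of F^(p·n), p = p2 + 2 prime, n = n1 + 1: coordinates are grouped
  -- into p blocks of length n, A = σ^n moves every block to the next one, and T = A − 1.
  module Blocks (p2 n1 : ℕ) (p-prime : Prime (suc (suc p2))) (char : suc (suc p2) ⊗ 1# ≡ 0#) where
    open Vectors
    open LinearMaps
    open Shift

    p n N : ℕ
    p = suc (suc p2)
    n = suc n1
    N = p Nat.* n

    A : V N → V N
    A = σ ^ n

    open Binomial A (^-linear σ-linear n) public using (T; T-linear)
    open Binomial A (^-linear σ-linear n) using (nilpotent)

    -- T^p = 0, since A^p = σ^(p·n) = 1.
    T-nilpotent : ∀ v → (T ^ p) v ≡ 0V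
    T-nilpotent = nilpotent (suc p2) p-prime char (sign-char (suc p2) p-prime char)
                    (λ v → trans (^-mult σ p n v) (σ-period v))

    σ^-T^ : ∀ j m v → (σ ^ j) ((T ^ m) v) ≡ (T ^ m) ((σ ^ j) v)
    σ^-T^ j m v = ^-intertwine σ^-T m v
      where
      σ^-T : ∀ v → (σ ^ j) (T v) ≡ T ((σ ^ j) v)
      σ^-T v = trans (-‿hom (^-linear σ-linear j) (A v) v) (cong (_-V (σ ^ j) v) (σ^-comm j n v))

    unshift : ∀ i → i Nat.< N → ∀ m x v → σ^ i x ≡ v → (T ^ m) x ≡ (σ ^ (N Nat.∸ i)) ((T ^ m) v)
    unshift i i<N m x v σⁱx≡v = begin
      (T ^ m) x                             ≡⟨ cong (T ^ m) x≡ ⟩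
      (T ^ m) ((σ ^ (N Nat.∸ i)) v)         ≡⟨ sym (σ^-T^ (N Nat.∸ i) m v) ⟩
      (σ ^ (N Nat.∸ i)) ((T ^ m) v)         ∎
      where
      open ≡-Reasoning
      x≡ : x ≡ (σ ^ (N Nat.∸ i)) v
      x≡ = trans (sym (σ-undo i (ℕP.<⇒≤ i<N) x)) (cong (σ ^ (N Nat.∸ i)) (trans (sym (σ^≡σ^ i x)) σⁱx≡v))

    -- On F^n, shifting N − i times and then (i mod n) times is a shift by a multiple of n.
    return-shift : ∀ i → i Nat.< N → ∀ (y : V n) → σ^ (i % n) ((σ ^ (N Nat.∸ i)) y) ≡ y
    return-shift i i<N y = begin
      σ^ (i % n) ((σ ^ (N Nat.∸ i)) y)          ≡⟨ σ^≡σ^ (i % n) _ ⟩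
      (σ ^ (i % n)) ((σ ^ (N Nat.∸ i)) y)       ≡⟨ sym (^-add σ (i % n) (N Nat.∸ i) y) ⟩
      (σ ^ (i % n Nat.+ (N Nat.∸ i))) y         ≡⟨ cong (λ m → (σ ^ m) y) (mod-complement p n i (ℕP.<⇒≤ i<N)) ⟩
      (σ ^ ((p Nat.∸ i / n) Nat.* n)) y         ≡⟨ σ-period-multiple (p Nat.∸ i / n) y ⟩
      y                                         ∎
      where open ≡-Reasoning

    lookup-T : ∀ v i → lookup (T v) i ≡ lookup v ((predMod ^ n) i) + (- 1#) * lookup v i
    lookup-T v i = trans (lookup-+V (A v) ((- 1#) ·V v) i) (cong₂ _+_ (lookup-σ^ n v i) (lookup-·V (- 1#) v i))

    ι : V n → V N
    ι y = y ++ 0V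

    ι-inside : ∀ y i (r : Fin n) → toℕ i ≡ toℕ r → lookup (ι y) i ≡ lookup y r
    ι-inside y i r i≡r = trans (VecP.lookup-++-< y 0V i i<n)
      (cong (lookup y) (FinP.toℕ-injective (trans (FinP.toℕ-fromℕ< i<n) i≡r)))
      where
      i<n : toℕ i Nat.< n
      i<n = subst (Nat._< n) (sym i≡r) (FinP.toℕ<n r)

    ι-outside : ∀ y i t → toℕ i ≡ n Nat.+ t → lookup (ι y) i ≡ 0#
    ι-outside y i t i≡ = trans (VecP.lookup-++-≥ y 0V i n≤i) (lookup-0V {suc p2 Nat.* n} (Fin.reduce≥ i n≤i))
      where
      n≤i : n Nat.≤ toℕ i
      n≤i = subst (n Nat.≤_) (sym i≡) (ℕP.m≤m+n n t)

    ι-linear : Linear ι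
    ι-linear = record
      { +-hom = λ x y → sym (trans (VecP.zipWith-++ _+_ x 0V y 0V) (cong ((x +V y) ++_) (+V-identityˡ 0V)))
      ; ·-hom = λ c x → sym (trans (VecP.map-++ (c *_) x 0V) (cong ((c ·V x) ++_) (·V-zeroʳ c))) }

    beyond-block : ∀ m y i t → toℕ i ≡ suc m Nat.* n Nat.+ t → lookup ((T ^ m) (ι y)) i ≡ 0#
    beyond-block zero    y i t i≡ = ι-outside y i t (trans i≡ (cong (Nat._+ t) (ℕP.+-identityʳ n)))
    beyond-block (suc m) y i t i≡ = begin
      lookup ((T ^ suc m) (ι y)) i
        ≡⟨ lookup-T ((T ^ m) (ι y)) i ⟩
      lookup ((T ^ m) (ι y)) ((predMod ^ n) i) + (- 1#) * lookup ((T ^ m) (ι y)) i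
        ≡⟨ cong₂ (λ a b → a + (- 1#) * b)
             (beyond-block m y _ t (predMod^-below n _ i (trans i≡ (ℕP.+-assoc n _ t))))
             (beyond-block m y i (n Nat.+ t)
               (trans i≡ (trans (cong (Nat._+ t) (ℕP.+-comm n (suc m Nat.* n))) (ℕP.+-assoc (suc m Nat.* n) n t)))) ⟩
      0# + (- 1#) * 0#
        ≡⟨ trans (+-identityˡ _) (zeroʳ _) ⟩
      0# ∎
      where open ≡-Reasoning

    on-block : ∀ m y i (r : Fin n) → toℕ i ≡ m Nat.* n Nat.+ toℕ r → lookup ((T ^ m) (ι y)) i ≡ lookup y r
    on-block zero    y i r i≡ = ι-inside y i r i≡
    on-block (suc m) y i r i≡ = begin
      lookup ((T ^ suc m) (ι y)) i
        ≡⟨ lookup-T ((T ^ m) (ι y)) i ⟩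
      lookup ((T ^ m) (ι y)) ((predMod ^ n) i) + (- 1#) * lookup ((T ^ m) (ι y)) i
        ≡⟨ cong₂ (λ a b → a + (- 1#) * b)
             (on-block m y _ r (predMod^-below n _ i (trans i≡ (ℕP.+-assoc n _ (toℕ r)))))
             (beyond-block m y i (toℕ r) i≡) ⟩
      lookup y r + (- 1#) * 0#
        ≡⟨ trans (cong (lookup y r +_) (zeroʳ _)) (+-identityʳ _) ⟩
      lookup y r ∎
      where open ≡-Reasoning

    -- Φ = T^(p−1) ∘ ι.  By triangularity its last block is y, so Φ is injective.
    Φ : V n → V N
    Φ y = (T ^ suc p2) (ι y)

    Φ-linear : Linear Φ
    Φ-linear = ∘-linear (^-linear T-linear (suc p2)) ι-linear

    Φ-injective : ∀ y → Φ y ≡ 0V → y ≡ 0V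
    Φ-injective y Φy≡0 = vext λ r → begin
      lookup y r                ≡⟨ sym (on-block (suc p2) y (last-block r) r (FinP.toℕ-fromℕ< (in-range r))) ⟩
      lookup (Φ y) (last-block r) ≡⟨ cong (λ v → lookup v (last-block r)) Φy≡0 ⟩
      lookup 0V (last-block r)  ≡⟨ lookup-0V (last-block r) ⟩
      0#                        ≡⟨ sym (lookup-0V r) ⟩
      lookup 0V r               ∎
      where
      open ≡-Reasoning
      in-range : ∀ (r : Fin n) → suc p2 Nat.* n Nat.+ toℕ r Nat.< N
      in-range r = subst (suc p2 Nat.* n Nat.+ toℕ r Nat.<_) (ℕP.+-comm (suc p2 Nat.* n) n)
                     (ℕP.+-monoʳ-< (suc p2 Nat.* n) (FinP.toℕ<n r))
      last-block : Fin n → Fin N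
      last-block r = Fin.fromℕ< (in-range r)

    e₀ : V N
    e₀ = 1# ∷ 0V

    e₀-off : ∀ i t → toℕ i ≡ suc t → lookup e₀ i ≡ 0#
    e₀-off (Fin.suc i) t _ = lookup-0V i

    -- N = M + 1.
    M : ℕ
    M = n1 Nat.+ suc p2 Nat.* n

    -- A wraps the first block around to the last one.
    first-block-wraps : ∀ i t → toℕ i ≡ t → t Nat.< n → toℕ ((predMod ^ n) i) ≡ suc (n1 Nat.+ p2 Nat.* n Nat.+ t)
    first-block-wraps i t i≡t (s≤s t≤n1) =
      subst (λ m → toℕ ((predMod ^ m) i) ≡ suc (n1 Nat.+ p2 Nat.* n Nat.+ t)) s+1+t≡n
        (predMod^-wrap t s (suc p2 Nat.* n Nat.+ t) i i≡t M≡s+u)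
      where
      s : ℕ
      s = n1 Nat.∸ t
      s+t≡n1 : s Nat.+ t ≡ n1
      s+t≡n1 = ℕP.m∸n+n≡m t≤n1
      s+1+t≡n : s Nat.+ suc t ≡ n
      s+1+t≡n = trans (ℕP.+-suc s t) (cong suc s+t≡n1)
      M≡s+u : M ≡ s Nat.+ (suc p2 Nat.* n Nat.+ t)
      M≡s+u = begin
        n1 Nat.+ suc p2 Nat.* n               ≡⟨ cong (Nat._+ suc p2 Nat.* n) (sym s+t≡n1) ⟩
        (s Nat.+ t) Nat.+ suc p2 Nat.* n      ≡⟨ ℕP.+-assoc s t _ ⟩
        s Nat.+ (t Nat.+ suc p2 Nat.* n)      ≡⟨ cong (s Nat.+_) (ℕP.+-comm t _) ⟩
        s Nat.+ (suc p2 Nat.* n Nat.+ t)      ∎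
        where open ≡-Reasoning

    -- A view on the indices of F^N that distinguishes the positions around the end of the
    -- first block: index 0, indices 1 … n−1, index n, and the indices beyond n.
    data Position : Fin N → Set where
      start    : Position Fin.zero
      within   : (r : Fin n1) (j : Fin M) → toℕ j ≡ toℕ r → Position (Fin.suc j)
      boundary : (j : Fin M) → toℕ j ≡ n1 → Position (Fin.suc j)
      beyond   : (j : Fin M) (t : ℕ) → toℕ j ≡ n Nat.+ t → Position (Fin.suc j)

    position : ∀ i → Position i
    position Fin.zero    = start
    position (Fin.suc j) with ℕP.<-cmp (toℕ j) n1
    ... | tri< j<n1 _ _ = within (Fin.fromℕ< j<n1) j (sym (FinP.toℕ-fromℕ< j<n1))
    ... | tri≈ _ j≡n1 _ = boundary j j≡n1
    ... | tri> _ _ j>n1 = beyond j (toℕ j Nat.∸ n) (sym (ℕP.m+[n∸m]≡n j>n1))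

    last-coordinate : V n → Carrier
    last-coordinate y = lookup y (Fin.fromℕ n1)

    σ-ι-combine : ∀ y i a b a′ b′ → lookup (σ (ι y)) i ≡ a → lookup (ι (σ y)) i ≡ b →
                  lookup e₀ ((predMod ^ n) i) ≡ a′ → lookup e₀ i ≡ b′ →
                  a ≡ b + last-coordinate y * (a′ + (- 1#) * b′) →
                  lookup (σ (ι y)) i ≡ lookup (ι (σ y)) i + last-coordinate y * lookup (T e₀) i
    σ-ι-combine y i a b a′ b′ σιy≡a ισy≡b e₀-back≡a′ e₀≡b′ a≡ =
      trans σιy≡a (trans a≡ (sym (cong₂ (λ u w → u + last-coordinate y * w) ισy≡b
        (trans (lookup-T e₀ i) (cong₂ (λ u w → u + (- 1#) * w) e₀-back≡a′ e₀≡b′)))))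

    cancels : ∀ c → 0# ≡ c + c * (0# + (- 1#) * 1#)
    cancels c = sym (begin
      c + c * (0# + (- 1#) * 1#) ≡⟨ cong (λ w → c + c * w) (trans (+-identityˡ _) (*-identityʳ _)) ⟩
      c + c * (- 1#)             ≡⟨ cong (c +_) (trans (*-comm c _) (-1*x≈-x c)) ⟩
      c + - c                    ≡⟨ -‿inverseʳ c ⟩
      0#                         ∎)
      where open ≡-Reasoning

    unchanged : ∀ c x → x ≡ x + c * (0# + (- 1#) * 0#)
    unchanged c x = sym (trans (cong (λ w → x + c * w) (trans (+-identityˡ _) (zeroʳ _)))
                         (trans (cong (x +_) (zeroʳ c)) (+-identityʳ x)))

    arrives : ∀ c → c ≡ 0# + c * (1# + (- 1#) * 0#)
    arrives c = sym (trans (+-identityˡ _) (trans (cong (c *_) (trans (cong (1# +_) (zeroʳ _)) (+-identityʳ 1#)))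
                                                  (*-identityʳ c)))

    -- Coordinatewise, σ (ι y) = ι (σ y) + c·T e₀ with c = y_(n−1): shifting ι y pushes c
    -- from index n−1 to index n, while ι (σ y) has it at index 0; and T e₀ = e_n − e_0.
    σ-ι-at : ∀ y i → Position i →
             lookup (σ (ι y)) i ≡ lookup (ι (σ y)) i + last-coordinate y * lookup (T e₀) i
    σ-ι-at y _ start = σ-ι-combine y Fin.zero 0# c 0# 1#
      (trans (lookup-σ (ι y) Fin.zero) (ι-outside y (Fin.fromℕ M) (n1 Nat.+ p2 Nat.* n)
        (trans (FinP.toℕ-fromℕ M) (x∙yz≈y∙xz n1 n (p2 Nat.* n)))))
      (trans (ι-inside (σ y) Fin.zero Fin.zero refl) (lookup-σ y Fin.zero))
      (e₀-off ((predMod ^ n) Fin.zero) _ (first-block-wraps Fin.zero 0 refl (s≤s z≤n))) refl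
      (cancels c)
      where
      open CommutativeSemigroupProperties ℕP.+-commutativeSemigroup using (x∙yz≈y∙xz)
      c : Carrier
      c = last-coordinate y
    σ-ι-at y _ (within r j j≡r) = σ-ι-combine y (Fin.suc j) yr yr 0# 0#
      (trans (lookup-σ (ι y) (Fin.suc j)) (ι-inside y (Fin.inject₁ j) (Fin.inject₁ r)
        (trans (FinP.toℕ-inject₁ j) (trans j≡r (sym (FinP.toℕ-inject₁ r))))))
      (trans (ι-inside (σ y) (Fin.suc j) (Fin.suc r) (cong suc j≡r)) (lookup-σ y (Fin.suc r)))
      (e₀-off ((predMod ^ n) (Fin.suc j)) _
        (first-block-wraps (Fin.suc j) (suc (toℕ r)) (cong suc j≡r) (s≤s (FinP.toℕ<n r))))
      (lookup-0V j)
      (unchanged (last-coordinate y) yr)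
      where
      yr : Carrier
      yr = lookup y (Fin.inject₁ r)
    σ-ι-at y _ (boundary j j≡n1) = σ-ι-combine y (Fin.suc j) c 0# 1# 0#
      (trans (lookup-σ (ι y) (Fin.suc j)) (ι-inside y (Fin.inject₁ j) (Fin.fromℕ n1)
        (trans (FinP.toℕ-inject₁ j) (trans j≡n1 (sym (FinP.toℕ-fromℕ n1))))))
      (ι-outside (σ y) (Fin.suc j) 0 j+1≡n+0)
      (cong (lookup e₀) (FinP.toℕ-injective (predMod^-below n 0 (Fin.suc j) j+1≡n+0)))
      (lookup-0V j)
      (arrives c)
      where
      c : Carrier
      c = last-coordinate y
      j+1≡n+0 : suc (toℕ j) ≡ n Nat.+ 0
      j+1≡n+0 = cong suc (trans j≡n1 (sym (ℕP.+-identityʳ n1)))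
    σ-ι-at y _ (beyond j t j≡) = σ-ι-combine y (Fin.suc j) 0# 0# 0# 0#
      (trans (lookup-σ (ι y) (Fin.suc j)) (ι-outside y (Fin.inject₁ j) t (trans (FinP.toℕ-inject₁ j) j≡)))
      (ι-outside (σ y) (Fin.suc j) (suc t) j+1≡n+t+1)
      (e₀-off ((predMod ^ n) (Fin.suc j)) t (predMod^-below n (suc t) (Fin.suc j) j+1≡n+t+1))
      (lookup-0V j)
      (unchanged (last-coordinate y) 0#)
      where
      j+1≡n+t+1 : suc (toℕ j) ≡ n Nat.+ suc t
      j+1≡n+t+1 = trans (cong suc j≡) (sym (ℕP.+-suc n t))

    σ-ι : ∀ y → σ (ι y) ≡ ι (σ y) +V (last-coordinate y ·V T e₀)
    σ-ι y = vext λ i → trans (σ-ι-at y i (position i))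
      (sym (trans (lookup-+V (ι (σ y)) (c ·V T e₀) i) (cong (lookup (ι (σ y)) i +_) (lookup-·V c (T e₀) i))))
      where
      c : Carrier
      c = last-coordinate y

    -- Φ commutes with σ: by σ-ι, σ (ι y) and ι (σ y) differ by an element of the image of T,
    -- which T^(p−1) kills since T^p = 0.
    Φ-σ : ∀ y → Φ (σ y) ≡ σ (Φ y)
    Φ-σ y = sym (begin
      σ (Φ y)                                 ≡⟨ σ^-T^ 1 (suc p2) (ι y) ⟩
      (T ^ suc p2) (σ (ι y))                  ≡⟨ cong (T ^ suc p2) (σ-ι y) ⟩
      (T ^ suc p2) (ι (σ y) +V (c ·V T e₀))   ≡⟨ +-hom (^-linear T-linear (suc p2)) _ _ ⟩
      Φ (σ y) +V (T ^ suc p2) (c ·V T e₀)     ≡⟨ cong (Φ (σ y) +V_) killed ⟩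
      Φ (σ y) +V 0V                           ≡⟨ +V-identityʳ _ ⟩
      Φ (σ y)                                 ∎)
      where
      open ≡-Reasoning
      c : Carrier
      c = last-coordinate y
      killed : (T ^ suc p2) (c ·V T e₀) ≡ 0V
      killed = begin
        (T ^ suc p2) (c ·V T e₀)   ≡⟨ ·-hom (^-linear T-linear (suc p2)) c (T e₀) ⟩
        c ·V (T ^ suc p2) (T e₀)   ≡⟨ cong (c ·V_) (sym (^-intertwine {f = T} {h = T} (λ _ → refl) (suc p2) e₀)) ⟩
        c ·V (T ^ p) e₀            ≡⟨ cong (c ·V_) (T-nilpotent e₀) ⟩
        c ·V 0V                    ≡⟨ ·V-zeroʳ c ⟩
        0V                         ∎

    Φ-σ^ : ∀ j y → Φ ((σ ^ j) y) ≡ (σ ^ j) (Φ y)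
    Φ-σ^ = ^-intertwine Φ-σ

  module Layers (p2 n1 : ℕ) (p-prime : Prime (suc (suc p2))) (char : suc (suc p2) ⊗ 1# ≡ 0#)
                (U : V (suc (suc p2) Nat.* suc n1) → Set) (U-subspace : IsSubspace U)
                {d : ℕ} (bU : Vec (V (suc (suc p2) Nat.* suc n1)) d) (bU-basis : IsBasis U bU)
                (U-covering : CyclicallyCovering U) where
    open Vectors
    open LinearMaps
    open Dimension
    open Shift
    open Blocks p2 n1 p-prime char
    open Scalars using (_≟_)

    Layer : ℕ → V n → Set
    Layer k y = ∃[ x ] (U x × (T ^ suc k) x ≡ 0V × (T ^ k) x ≡ Φ y)

    layer-subspace : ∀ k → IsSubspace (Layer k)
    layer-subspace k = preimage-subspace (^-linear T-linear (suc k)) (^-linear T-linear k) Φ-linear U-subspace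

    -- Membership in a layer is decidable: it suffices to search the coordinates of x.
    layer-decidable : ∀ k y → Dec (Layer k y)
    layer-decidable k y = map′ to-layer from-layer
      (any-vector? (λ c → VecP.≡-dec _≟_ ((T ^ suc k) (lincomb c bU)) 0V
                            ×-dec VecP.≡-dec _≟_ ((T ^ k) (lincomb c bU)) (Φ y)))
      where
      to-layer : ∃[ c ] ((T ^ suc k) (lincomb c bU) ≡ 0V × (T ^ k) (lincomb c bU) ≡ Φ y) → Layer k y
      to-layer (c , killed , top) = lincomb c bU , lincomb-mem U-subspace c bU (IsBasis.in-U bU-basis) , killed , top
      from-layer : Layer k y → ∃[ c ] ((T ^ suc k) (lincomb c bU) ≡ 0V × (T ^ k) (lincomb c bU) ≡ Φ y)
      from-layer (x , x∈U , killed , top) with IsBasis.spanning bU-basis x x∈U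
      ... | c , refl = c , killed , top

    -- Every layer Layer k with k < p is cyclically covering: T^(p−1−k) (ι y) reaches Φ y
    -- after k more steps of T, a shift of it lies in U, and shifting back brings y
    -- into Layer k up to a shift by a multiple of n.
    layer-covering : ∀ k → k Nat.< p → CyclicallyCovering (Layer k)
    layer-covering k (s≤s k≤p−1) y = from-witness (U-covering v)
      where
      v : V N
      v = (T ^ (suc p2 Nat.∸ k)) (ι y)
      Tᵏv≡Φy : (T ^ k) v ≡ Φ y
      Tᵏv≡Φy = trans (sym (^-add T k _ (ι y))) (cong (λ m → (T ^ m) (ι y)) (ℕP.m+[n∸m]≡n k≤p−1))
      Tᵏ⁺¹v≡0 : (T ^ suc k) v ≡ 0V
      Tᵏ⁺¹v≡0 = trans (cong T Tᵏv≡Φy) (T-nilpotent (ι y))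
      from-witness : ∃[ i ] (i Nat.< N × ∃[ x ] (U x × σ^ i x ≡ v)) →
                     ∃[ j ] (j Nat.< n × ∃[ z ] (Layer k z × σ^ j z ≡ y))
      from-witness (i , i<N , x , x∈U , σⁱx≡v) =
        i % n , m%n<n i n , (σ ^ (N Nat.∸ i)) y , (x , x∈U , killed , top) , return-shift i i<N y
        where
        killed : (T ^ suc k) x ≡ 0V
        killed = trans (unshift i i<N (suc k) x v σⁱx≡v)
                   (trans (cong (σ ^ (N Nat.∸ i)) Tᵏ⁺¹v≡0) (0-hom (^-linear σ-linear (N Nat.∸ i))))
        top : (T ^ k) x ≡ Φ ((σ ^ (N Nat.∸ i)) y)
        top = trans (unshift i i<N k x v σⁱx≡v)
                (trans (cong (σ ^ (N Nat.∸ i)) Tᵏv≡Φy) (sym (Φ-σ^ (N Nat.∸ i) y)))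

    layer-basis : ∀ k → ∃[ e ] HasDim (Layer k) e
    layer-basis k = basis-exists (Layer k) (layer-decidable k)

    dim : ℕ → ℕ
    dim k = proj₁ (layer-basis k)

    basis : ∀ k → Vec (V n) (dim k)
    basis k = proj₁ (proj₂ (layer-basis k))

    basis-is-basis : ∀ k → IsBasis (Layer k) (basis k)
    basis-is-basis k = proj₂ (proj₂ (layer-basis k))

    LiftOf : ℕ → V n → V N → Set
    LiftOf k y x = U x × (T ^ suc k) x ≡ 0V × (T ^ k) x ≡ Φ y

    lift : ∀ k → Vec (V N) (dim k)
    lift k = Vec.tabulate (λ j → proj₁ (IsBasis.in-U (basis-is-basis k) j))

    lift-property : ∀ k j → LiftOf k (lookup (basis k) j) (lookup (lift k) j)
    lift-property k j = subst (LiftOf k (lookup (basis k) j)) (sym (VecP.lookup∘tabulate _ j))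
                          (proj₂ (IsBasis.in-U (basis-is-basis k) j))

    -- T^k maps the lift of layer k onto Φ of the basis of layer k, which is independent.
    lift-top-independent : ∀ k c → (T ^ k) (lincomb c (lift k)) ≡ 0V → ∀ j → lookup c j ≡ 0#
    lift-top-independent k c top≡0 = IsBasis.independent (basis-is-basis k) c
      (Φ-injective _ (trans (sym top-image) top≡0))
      where
      open ≡-Reasoning
      top-image : (T ^ k) (lincomb c (lift k)) ≡ Φ (lincomb c (basis k))
      top-image = begin
        (T ^ k) (lincomb c (lift k))          ≡⟨ lincomb-map (^-linear T-linear k) c (lift k) ⟩
        lincomb c (map (T ^ k) (lift k))      ≡⟨ cong (lincomb c) (vext λ j →
          trans (VecP.lookup-map j (T ^ k) (lift k))
            (trans (proj₂ (proj₂ (lift-property k j))) (sym (VecP.lookup-map j Φ (basis k))))) ⟩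
        lincomb c (map Φ (basis k))           ≡⟨ sym (lincomb-map Φ-linear c (basis k)) ⟩
        Φ (lincomb c (basis k))               ∎

    lifts : ∀ m → Vec (V N) (sumBelow dim m)
    lifts zero    = []
    lifts (suc m) = lift m ++ lifts m

    lifts-in-U : ∀ m j → U (lookup (lifts m) j)
    lifts-in-U zero    ()
    lifts-in-U (suc m) = ++-every {P = U} (lift m) (lifts m) (λ j → proj₁ (lift-property m j)) (lifts-in-U m)

    lifts-killed : ∀ m j → (T ^ m) (lookup (lifts m) j) ≡ 0V
    lifts-killed zero    ()
    lifts-killed (suc m) = ++-every {P = λ x → (T ^ suc m) x ≡ 0V} (lift m) (lifts m)
      (λ j → proj₁ (proj₂ (lift-property m j)))
      (λ j → trans (cong T (lifts-killed m j)) (0-hom T-linear))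

    lifts-independent : ∀ m → Independent (lifts m)
    lifts-independent zero    c _ ()
    lifts-independent (suc m) = independent-++ (^-linear T-linear m) (lift m) (lifts m)
      (lift-top-independent m) (lifts-killed m) (lifts-independent m)

    total-dim : sumBelow dim p Nat.≤ d
    total-dim = independent-in-span bU (lifts p) (lifts-independent p)
                  (λ j → IsBasis.spanning bU-basis _ (lifts-in-U p j))

open import Data.Nat using (ℕ; suc; _*_; _^_; _∸_; _≤_)
open import Data.Nat.Primality using (Prime)
open import Data.Product using (∃-syntax; _×_)

theorem6p2 : ∀ (p k : ℕ) → Prime p → (F : FiniteField (p ^ suc k)) →
    ∀ (n : ℕ) →
      let open LinearAlgebra F in
      ∀ (U : V (p * n) → Set) (d : ℕ) →
        IsSubspace U → HasDim U d → CyclicallyCovering U →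
        ∃[ W ] ∃[ e ] (IsSubspace {n} W × HasDim W e × CyclicallyCovering W
                        × (p * n ∸ d ≤ p * (n ∸ e)))
-- p = 0 and p = 1 are not prime; F^0 admits no shift index i < 0, so it has no covering subspace.
theorem6p2 zero           k p-prime = ⊥-elim (¬prime[0] p-prime)
theorem6p2 (suc zero)     k p-prime = ⊥-elim (¬prime[1] p-prime)
theorem6p2 (suc (suc p2)) k p-prime F zero U d _ _ U-covering
  with U-covering (LinearAlgebra.0V F)
... | i , i<p·0 , _ = ⊥-elim (ℕP.n≮0 (subst (i Nat.<_) (ℕP.*-zeroʳ (suc (suc p2))) i<p·0))
theorem6p2 (suc (suc p2)) k p-prime F (suc n1) U d U-subspace (bU , bU-basis) U-covering =
  Layer m , dim m , layer-subspace m , proj₂ (layer-basis m) , layer-covering m m<p ,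
  codim-bound p n d (dim m) (ℕP.≤-trans p·dim[m]≤total total-dim)
  where
  p n : ℕ
  p = suc (suc p2)
  n = suc n1
  open FieldTheory F
  open Layers p2 n1 p-prime (Scalars.char-from-card p k refl) U U-subspace bU bU-basis U-covering
  smallest : ∃[ m ] (m Nat.< p × p * dim m ≤ sumBelow dim p)
  smallest = below-average dim (suc p2)
  m : ℕ
  m = proj₁ smallest
  m<p : m Nat.< p
  m<p = proj₁ (proj₂ smallest)
  p·dim[m]≤total : p * dim m ≤ sumBelow dim p
  p·dim[m]≤total = proj₂ (proj₂ smallest)
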